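{- Let $T$ be a finite set of tense formulas with $\top,\bot\in T$. For any $X,Y\subseteq FS(T^\circ)$ and any $\varphi\in T^\circ$: (1) $[\![\top]\!]=FS(T^\circ)$; (2) $C(X)=[\![\chi]\!]$ for some formula $\chi\in T^\circ$; (3) $X\subseteq C(X)$; (4) if $X\subseteq Y$ then $C(X)\subseteq C(Y)$; (5) $C(C(X))\subseteq C(X)$; (6) $C([\![\varphi]\!])=[\![\varphi]\!]$.
   Context: Tense formulas are built from a countable set of propositional variables using $\bot,\top$, unary $\neg,\Diamond,\blacksquare$ and binary $\wedge,\vee$; $\Diamond^0\varphi=\varphi$, $\Diamond^{k+1}\varphi=\Diamond\Diamond^k\varphi$. Formula structures: $\langle\varphi\rangle^n$ is the formal expression obtained by applying a unary structural operator $\langle\cdot\rangle$ $n$ times to the formula $\varphi$ ($\langle\varphi\rangle^0=\varphi$); if $\Gamma=\langle\varphi\rangle^n$ then $\langle\Gamma\rangle^k=\langle\varphi\rangle^{n+k}$. For a set of formulas $X$, $FS(X)=\{\langle\varphi\rangle^n\mid\varphi\in X,\ n\geq0\}$. The calculus $\mathsf{G}$ has axioms (arbitrary formulas, $n\geq0$): $\varphi\Rightarrow\varphi$; $\varphi\wedge(\psi\vee\chi)\Rightarrow(\varphi\wedge\psi)\vee(\varphi\wedge\chi)$; $\varphi\Rightarrow\top$; $\langle\bot\rangle^n\Rightarrow\psi$; $\varphi\wedge\neg\varphi\Rightarrow\bot$; $\top\Rightarrow\varphi\vee\neg\varphi$; $\Diamond^3\varphi\Rightarrow\Diamond^2\varphi$;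 and rules (arbitrary $n\geq0$): from $\langle\varphi_i\rangle^n\Rightarrow\psi$ infer $\langle\varphi_1\wedge\varphi_2\rangle^n\Rightarrow\psi$ ($i=1,2$); from $\Gamma\Rightarrow\psi_1$, $\Gamma\Rightarrow\psi_2$ infer $\Gamma\Rightarrow\psi_1\wedge\psi_2$; from $\langle\varphi_1\rangle^n\Rightarrow\psi$, $\langle\varphi_2\rangle^n\Rightarrow\psi$ infer $\langle\varphi_1\vee\varphi_2\rangle^n\Rightarrow\psi$; from $\Gamma\Rightarrow\psi_i$ infer $\Gamma\Rightarrow\psi_1\vee\psi_2$; from $\langle\varphi\rangle^{n+1}\Rightarrow\psi$ infer $\langle\Diamond\varphi\rangle^n\Rightarrow\psi$; from $\Gamma\Rightarrow\psi$ infer $\langle\Gamma\rangle\Rightarrow\Diamond\psi$; from $\langle\varphi\rangle^n\Rightarrow\psi$ infer $\langle\blacksquare\varphi\rangle^{n+1}\Rightarrow\psi$; from $\langle\Gamma\rangle\Rightarrow\psi$ infer $\Gamma\Rightarrow\blacksquare\psi$; from $\Gamma\Rightarrow\varphi$ and $\langle\varphi\rangle^n\Rightarrow\psi$ infer $\langle\Gamma\rangle^n\Rightarrow\psi$ (Cut). A derivation is a finite tree of sequents each node of which is an axiom instance or obtained from its children by a rule. $T^\Diamond=\{\Diamond^k\varphi\mid\varphi\in T,\ 0\leq k\leq 3\}$; $T^\circ$ is the smallest set containing $T^\Diamond$ closed under $\neg,\wedge,\vee$; $T^\bullet=T^\circ\setminus T^\Diamond$. $\mathsf{G}\vdash\Gamma\Rightarrow_{T^\circ}\psi$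 means there is a derivation of $\Gamma\Rightarrow\psi$ in $\mathsf{G}$ all of whose formulas lie in $T^\circ$. For $\varphi\in T^\circ$: $G(\varphi)=\{\langle\chi\rangle^n\in FS(T^\Diamond)\mid\mathsf{G}\vdash\langle\chi\rangle^n\Rightarrow_{T^\circ}\varphi\}$, $[\![\varphi]\!]=G(\varphi)\cup FS(T^\bullet)$, $[\![T^\circ]\!]=\{[\![\varphi]\!]\mid\varphi\in T^\circ\}$. For $X\subseteq FS(T^\circ)$, $C(X)=\bigcap\{[\![\varphi]\!]\mid X\subseteq[\![\varphi]\!]\in[\![T^\circ]\!]\}$. -}

module Defs where

open import Level using (0ℓ)
open import Data.Nat using (ℕ; zero; suc; _+_; _≤_)
open import Data.List using (List)
open import Data.List.Membership.Propositional using (_∈_)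
open import Data.Product using (Σ; _×_; _,_; ∃)
open import Data.Sum using (_⊎_)
open import Data.Unit using (⊤)
open import Relation.Nullary using (¬_)
open import Relation.Binary.PropositionalEquality using (_≡_)
open import Relation.Unary using (Pred; _⊆_)

infixr 6 _∧f_
infixr 5 _∨f_
data Fm : Set where
  var  : ℕ → Fm
  ⊥f   : Fm
  ⊤f   : Fm
  ¬f_  : Fm → Fm
  ◇_   : Fm → Fm
  ■_   : Fm → Fm
  _∧f_ : Fm → Fm → Fm
  _∨f_ : Fm → Fm → Fm

◇^ : ℕ → Fm → Fm
◇^ zero    φ = φ
◇^ (suc k) φ = ◇ (◇^ k φ)

-- Formula structures ⟨φ⟩^n, represented by the pair (φ , n)
record Struct : Set where
  constructor ⟨_⟩^_
  field
    fm    : Fm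
    depth : ℕ
open Struct public

⟨_⟩ : Struct → Struct
⟨ ⟨ φ ⟩^ n ⟩ = ⟨ φ ⟩^ suc n

⟨_⟩^^_ : Struct → ℕ → Struct
⟨ ⟨ φ ⟩^ n ⟩^^ k = ⟨ φ ⟩^ (n + k)

infix 4 _⇒_
data _⇒_ : Struct → Fm → Set where
  ax-id   : ∀ φ → ⟨ φ ⟩^ 0 ⇒ φ
  ax-dist : ∀ φ ψ χ → ⟨ φ ∧f (ψ ∨f χ) ⟩^ 0 ⇒ (φ ∧f ψ) ∨f (φ ∧f χ)
  ax-top  : ∀ φ → ⟨ φ ⟩^ 0 ⇒ ⊤f
  ax-bot  : ∀ n ψ → ⟨ ⊥f ⟩^ n ⇒ ψ
  ax-contr : ∀ φ → ⟨ φ ∧f ¬f φ ⟩^ 0 ⇒ ⊥f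
  ax-lem  : ∀ φ → ⟨ ⊤f ⟩^ 0 ⇒ φ ∨f ¬f φ
  ax-dia  : ∀ φ → ⟨ ◇^ 3 φ ⟩^ 0 ⇒ ◇^ 2 φ
  ∧L₁ : ∀ {φ₁ φ₂ n ψ} → ⟨ φ₁ ⟩^ n ⇒ ψ → ⟨ φ₁ ∧f φ₂ ⟩^ n ⇒ ψ
  ∧L₂ : ∀ {φ₁ φ₂ n ψ} → ⟨ φ₂ ⟩^ n ⇒ ψ → ⟨ φ₁ ∧f φ₂ ⟩^ n ⇒ ψ
  ∧R  : ∀ {Γ ψ₁ ψ₂} → Γ ⇒ ψ₁ → Γ ⇒ ψ₂ → Γ ⇒ ψ₁ ∧f ψ₂
  ∨L  : ∀ {φ₁ φ₂ n ψ} → ⟨ φ₁ ⟩^ n ⇒ ψ → ⟨ φ₂ ⟩^ n ⇒ ψ → ⟨ φ₁ ∨f φ₂ ⟩^ n ⇒ ψ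
  ∨R₁ : ∀ {Γ ψ₁ ψ₂} → Γ ⇒ ψ₁ → Γ ⇒ ψ₁ ∨f ψ₂
  ∨R₂ : ∀ {Γ ψ₁ ψ₂} → Γ ⇒ ψ₂ → Γ ⇒ ψ₁ ∨f ψ₂
  ◇L  : ∀ {φ n ψ} → ⟨ φ ⟩^ suc n ⇒ ψ → ⟨ ◇ φ ⟩^ n ⇒ ψ
  ◇R  : ∀ {Γ ψ} → Γ ⇒ ψ → ⟨ Γ ⟩ ⇒ ◇ ψ
  ■L  : ∀ {φ n ψ} → ⟨ φ ⟩^ n ⇒ ψ → ⟨ ■ φ ⟩^ suc n ⇒ ψ
  ■R  : ∀ {Γ ψ} → ⟨ Γ ⟩ ⇒ ψ → Γ ⇒ ■ ψ
  cut : ∀ {Γ φ n ψ} → Γ ⇒ φ → ⟨ φ ⟩^ n ⇒ ψ → ⟨ Γ ⟩^^ n ⇒ ψ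

AllIn : (P : Pred Fm 0ℓ) → ∀ {Γ ψ} → Γ ⇒ ψ → Set
AllIn P {Γ} {ψ} d = (P (fm Γ) × P ψ) × sub d
  where
  sub : ∀ {Γ ψ} → Γ ⇒ ψ → Set
  sub (ax-id _) = ⊤
  sub (ax-dist _ _ _) = ⊤
  sub (ax-top _) = ⊤
  sub (ax-bot _ _) = ⊤
  sub (ax-contr _) = ⊤
  sub (ax-lem _) = ⊤
  sub (ax-dia _) = ⊤
  sub (∧L₁ d) = AllIn P d
  sub (∧L₂ d) = AllIn P d
  sub (∧R d e) = AllIn P d × AllIn P e
  sub (∨L d e) = AllIn P d × AllIn P e
  sub (∨R₁ d) = AllIn P d
  sub (∨R₂ d) = AllIn P d
  sub (◇L d) = AllIn P d
  sub (◇R d) = AllIn P d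
  sub (■L d) = AllIn P d
  sub (■R d) = AllIn P d
  sub (cut d e) = AllIn P d × AllIn P e

_⊢_⇒_ : Pred Fm 0ℓ → Struct → Fm → Set
P ⊢ Γ ⇒ ψ = Σ (Γ ⇒ ψ) (AllIn P)

module _ (T : List Fm) where

  TDia : Pred Fm 0ℓ
  TDia ψ = Σ Fm λ φ → Σ ℕ λ k → φ ∈ T × k ≤ 3 × ψ ≡ ◇^ k φ

  data TCirc : Fm → Set where
    base : ∀ {ψ} → TDia ψ → TCirc ψ
    neg  : ∀ {ψ} → TCirc ψ → TCirc (¬f ψ)
    conj : ∀ {ψ χ} → TCirc ψ → TCirc χ → TCirc (ψ ∧f χ)
    disj : ∀ {ψ χ} → TCirc ψ → TCirc χ → TCirc (ψ ∨f χ)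

  TBul : Pred Fm 0ℓ
  TBul ψ = TCirc ψ × ¬ TDia ψ

  FS : Pred Fm 0ℓ → Pred Struct 0ℓ
  FS X Γ = X (fm Γ)

  Gset : Fm → Pred Struct 0ℓ
  Gset φ Γ = FS TDia Γ × (TCirc ⊢ Γ ⇒ φ)

  ⟦_⟧ : Fm → Pred Struct 0ℓ
  ⟦ φ ⟧ Γ = Gset φ Γ ⊎ FS TBul Γ

  Cl : Pred Struct 0ℓ → Pred Struct 0ℓ
  Cl X Γ = ∀ φ → TCirc φ → X ⊆ ⟦ φ ⟧ → ⟦ φ ⟧ Γ

module Submission where

-- Shannon expansion over a
--    list of formulas L ('branches', 'cover') reduces a refutation of m ∧ p to
--    refutations on branches deciding every formula of L.  The axiom ◇³⊤ ⇒ ◇²⊤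
--    makes ⊤ derivable from ⟨ψ⟩^n at every depth n.
--  * 'Lattice T': ⟦⊤⟧ = FS(T°) (decide whether ψ ∈ T^◇); ⟦_⟧ is monotone and
--    preserves finite meets.  Given excluded middle, χ is the meet, over all
--    branches b of the atoms, of a bound of X refuted by b (if any); since each
--    branch decides every T°-formula, χ ⊑ φ for every φ with X ⊆ ⟦φ⟧.
--  * Items (3)-(6) hold for any intersection of a family of sets ('Cl-…').

open import Defs
open import Level using (0ℓ)
open import Function using (_∘_; id)
open import Data.Nat using (ℕ; zero; suc; _≟_; _≤_; z≤n; s≤s; s≤s⁻¹)
open import Data.Nat.Properties using (+-identityʳ)
open import Data.List using (List; []; _∷_; _++_; map; concatMap; applyUpTo)
open import Data.List.Membership.Propositional using (_∈_; find; lose)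
open import Data.List.Membership.Propositional.Properties
  using (∈-++⁺ˡ; ∈-++⁺ʳ; ∈-++⁻; ∈-map⁺; ∈-concatMap⁺; ∈-concatMap⁻; ∈-applyUpTo⁺; ∈-applyUpTo⁻)
open import Data.List.Relation.Unary.Any using (here; there)
open import Data.List.Relation.Unary.All using (All; []; _∷_; universal)
import Data.List.Relation.Unary.All as All
open import Data.List.Relation.Unary.All.Properties using (map⁺)
open import Data.Product using (Σ; _×_; _,_; proj₁; proj₂; uncurry)
open import Data.Sum using (_⊎_; inj₁; inj₂)
open import Data.Unit using (tt)
open import Data.Empty using (⊥-elim)
open import Relation.Nullary using (Dec; yes; no)
open import Relation.Nullary.Decidable using (map′; _×-dec_)
open import Relation.Binary.Definitions using (DecidableEquality)
open import Relation.Binary.PropositionalEquality using (_≡_; refl; subst; cong; cong₂)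
open import Relation.Unary using (Pred; _⊆_; _≐_)
open import Axiom.ExcludedMiddle using (ExcludedMiddle)

head : Fm → ℕ
head (var _)  = 0
head ⊥f       = 1
head ⊤f       = 2
head (¬f _)   = 3
head (◇ _)    = 4
head (■ _)    = 5
head (_ ∧f _) = 6
head (_ ∨f _) = 7

-- Equality of formulas is decidable: formulas with different heads differ, and
-- formulas with the same head are compared argumentwise.
infix 4 _≟F_
_≟F_ : DecidableEquality Fm
sameHead : ∀ a b → head a ≡ head b → Dec (a ≡ b)
a ≟F b with head a ≟ head b
... | yes same = sameHead a b same
... | no differ = no (differ ∘ cong head)
sameHead (var m)  (var n)  refl = map′ (cong var) (λ { refl → refl }) (m ≟ n)
sameHead ⊥f       ⊥f       refl = yes refl
sameHead ⊤f       ⊤f       refl = yes refl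
sameHead (¬f a)   (¬f b)   refl = map′ (cong ¬f_) (λ { refl → refl }) (a ≟F b)
sameHead (◇ a)    (◇ b)    refl = map′ (cong ◇_) (λ { refl → refl }) (a ≟F b)
sameHead (■ a)    (■ b)    refl = map′ (cong ■_) (λ { refl → refl }) (a ≟F b)
sameHead (a ∧f b) (c ∧f d) refl =
  map′ (uncurry (cong₂ _∧f_)) (λ { refl → refl , refl }) (a ≟F c ×-dec b ≟F d)
sameHead (a ∨f b) (c ∨f d) refl =
  map′ (uncurry (cong₂ _∨f_)) (λ { refl → refl , refl }) (a ≟F c ×-dec b ≟F d)

open import Data.List.Membership.DecPropositional _≟F_ using (_∈?_)

atoms : List Fm → List Fm
atoms = concatMap (λ φ → applyUpTo (λ k → ◇^ k φ) 4)

atoms-complete : ∀ T {ψ} → TDia T ψ → ψ ∈ atoms T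
atoms-complete T (φ , k , φ∈T , k≤3 , refl) =
  ∈-concatMap⁺ _ (lose φ∈T (∈-applyUpTo⁺ (λ j → ◇^ j φ) (s≤s k≤3)))

atoms-sound : ∀ T {ψ} → ψ ∈ atoms T → TDia T ψ
atoms-sound T ψ∈ with find (∈-concatMap⁻ _ ψ∈)
... | φ , φ∈T , ψ∈◇φ with ∈-applyUpTo⁻ (λ j → ◇^ j φ) ψ∈◇φ
...   | k , k<4 , refl = φ , k , φ∈T , s≤s⁻¹ k<4 , refl

TDia? : ∀ T ψ → Dec (TDia T ψ)
TDia? T ψ = map′ (atoms-sound T) (atoms-complete T) (ψ ∈? atoms T)

⋀ : List Fm → Fm
⋀ []       = ⊤f
⋀ (a ∷ as) = a ∧f ⋀ as

branches : List Fm → Fm → List Fm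
branches []      m = m ∷ []
branches (a ∷ L) m = branches L (m ∧f a) ++ branches L (m ∧f ¬f a)

module Calculus {P : Pred Fm 0ℓ} (P⊤ : P ⊤f) (P⊥ : P ⊥f)
                (P¬ : ∀ {a} → P a → P (¬f a))
                (P∧ : ∀ {a b} → P a → P b → P (a ∧f b))
                (P∨ : ∀ {a b} → P a → P b → P (a ∨f b)) where

  infix 4 _⊑_
  _⊑_ : Fm → Fm → Set
  a ⊑ b = P ⊢ ⟨ a ⟩^ 0 ⇒ b

  srcP : ∀ {Γ c} → P ⊢ Γ ⇒ c → P (fm Γ)
  srcP (_ , (p , _) , _) = p

  tgtP : ∀ {Γ c} → P ⊢ Γ ⇒ c → P c
  tgtP (_ , (_ , p) , _) = p

  ∧L₁ᴾ : ∀ {a b n c} → P b → P ⊢ ⟨ a ⟩^ n ⇒ c → P ⊢ ⟨ a ∧f b ⟩^ n ⇒ c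
  ∧L₁ᴾ pb d@(d₀ , s) = ∧L₁ d₀ , (P∧ (srcP d) pb , tgtP d) , s

  ∧L₂ᴾ : ∀ {a b n c} → P a → P ⊢ ⟨ b ⟩^ n ⇒ c → P ⊢ ⟨ a ∧f b ⟩^ n ⇒ c
  ∧L₂ᴾ pa d@(d₀ , s) = ∧L₂ d₀ , (P∧ pa (srcP d) , tgtP d) , s

  ∧Rᴾ : ∀ {Γ a b} → P ⊢ Γ ⇒ a → P ⊢ Γ ⇒ b → P ⊢ Γ ⇒ (a ∧f b)
  ∧Rᴾ d@(d₀ , s) e@(e₀ , t) = ∧R d₀ e₀ , (srcP d , P∧ (tgtP d) (tgtP e)) , s , t

  ∨Lᴾ : ∀ {a b n c} → P ⊢ ⟨ a ⟩^ n ⇒ c → P ⊢ ⟨ b ⟩^ n ⇒ c → P ⊢ ⟨ a ∨f b ⟩^ n ⇒ c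
  ∨Lᴾ d@(d₀ , s) e@(e₀ , t) = ∨L d₀ e₀ , (P∨ (srcP d) (srcP e) , tgtP d) , s , t

  ∨R₁ᴾ : ∀ {Γ a b} → P b → P ⊢ Γ ⇒ a → P ⊢ Γ ⇒ (a ∨f b)
  ∨R₁ᴾ pb d@(d₀ , s) = ∨R₁ d₀ , (srcP d , P∨ (tgtP d) pb) , s

  ∨R₂ᴾ : ∀ {Γ a b} → P a → P ⊢ Γ ⇒ b → P ⊢ Γ ⇒ (a ∨f b)
  ∨R₂ᴾ pa d@(d₀ , s) = ∨R₂ d₀ , (srcP d , P∨ pa (tgtP d)) , s

  ◇Rᴾ : ∀ {ψ n a} → P (◇ a) → P ⊢ ⟨ ψ ⟩^ n ⇒ a → P ⊢ (⟨ ψ ⟩^ suc n) ⇒ (◇ a)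
  ◇Rᴾ p◇a d@(d₀ , s) = ◇R d₀ , (srcP d , p◇a) , s

  cutᴾ : ∀ {ψ n a b} → P ⊢ ⟨ ψ ⟩^ n ⇒ a → a ⊑ b → P ⊢ ⟨ ψ ⟩^ n ⇒ b
  cutᴾ {ψ} {n} {b = b} d@(d₀ , s) e@(e₀ , t) =
    subst (λ k → P ⊢ ⟨ ψ ⟩^ k ⇒ b) (+-identityʳ n)
          (cut d₀ e₀ , (srcP d , tgtP e) , s , t)

  ⊑-refl : ∀ {a} → P a → a ⊑ a
  ⊑-refl {a} pa = ax-id a , (pa , pa) , tt

  ⊤-intro : ∀ {a} → P a → a ⊑ ⊤f
  ⊤-intro {a} pa = ax-top a , (pa , P⊤) , tt

  ex-falso : ∀ {a} → P a → ⊥f ⊑ a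
  ex-falso {a} pa = ax-bot 0 a , (P⊥ , pa) , tt

  distrib : ∀ {a b c} → P a → P b → P c → a ∧f (b ∨f c) ⊑ (a ∧f b) ∨f (a ∧f c)
  distrib {a} {b} {c} pa pb pc =
    ax-dist a b c , (P∧ pa (P∨ pb pc) , P∨ (P∧ pa pb) (P∧ pa pc)) , tt

  non-contradiction : ∀ {a} → P a → a ∧f ¬f a ⊑ ⊥f
  non-contradiction {a} pa = ax-contr a , (P∧ pa (P¬ pa) , P⊥) , tt

  excluded-middle : ∀ {a} → P a → ⊤f ⊑ a ∨f ¬f a
  excluded-middle {a} pa = ax-lem a , (P⊤ , P∨ pa (P¬ pa)) , tt

  ⊑-trans : ∀ {a b c} → a ⊑ b → b ⊑ c → a ⊑ c
  ⊑-trans = cutᴾ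

  ∧-fst : ∀ {a b} → P a → P b → a ∧f b ⊑ a
  ∧-fst pa pb = ∧L₁ᴾ pb (⊑-refl pa)

  ∧-snd : ∀ {a b} → P a → P b → a ∧f b ⊑ b
  ∧-snd pa pb = ∧L₂ᴾ pa (⊑-refl pb)

  by-cases : ∀ {p a c} → P p → P a → p ∧f a ⊑ c → p ∧f ¬f a ⊑ c → p ⊑ c
  by-cases pp pa if-a if-¬a =
    ⊑-trans (∧Rᴾ (⊑-refl pp) (⊑-trans (⊤-intro pp) (excluded-middle pa)))
            (⊑-trans (distrib pp pa (P¬ pa)) (∨Lᴾ if-a if-¬a))

  refute : ∀ {x a} → x ⊑ a → x ⊑ ¬f a → x ⊑ ⊥f
  refute h k = ⊑-trans (∧Rᴾ h k) (non-contradiction (tgtP h))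

  ¬-intro : ∀ {a b} → P a → P b → a ∧f b ⊑ ⊥f → a ⊑ ¬f b
  ¬-intro pa pb h = by-cases pa pb (⊑-trans h (ex-falso (P¬ pb))) (∧-snd pa (P¬ pb))

  ¬¬-intro : ∀ {a} → P a → a ⊑ ¬f ¬f a
  ¬¬-intro pa = ¬-intro pa (P¬ pa) (non-contradiction pa)

  ¬¬-elim : ∀ {a} → P a → ¬f ¬f a ⊑ a
  ¬¬-elim {a} pa = by-cases p¬¬a pa (∧-snd p¬¬a pa)
    (⊑-trans (refute (∧-snd p¬¬a (P¬ pa)) (∧-fst p¬¬a (P¬ pa))) (ex-falso pa))
    where
    p¬¬a : P (¬f ¬f a)
    p¬¬a = P¬ (P¬ pa)

  ¬-antitone : ∀ {a b} → a ⊑ b → ¬f b ⊑ ¬f a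
  ¬-antitone {a} {b} h =
    ¬-intro (P¬ pb) pa (refute (⊑-trans (∧-snd (P¬ pb) pa) h) (∧-fst (P¬ pb) pa))
    where
    pa : P a
    pa = srcP h
    pb : P b
    pb = tgtP h

  ¬-∨ : ∀ {a b} → P a → P b → ¬f a ∧f ¬f b ⊑ ¬f (a ∨f b)
  ¬-∨ {a} {b} pa pb = ¬-intro pn (P∨ pa pb)
    (⊑-trans (distrib pn pa pb)
             (∨Lᴾ (refute (∧-snd pn pa) (⊑-trans (∧-fst pn pa) (∧-fst (P¬ pa) (P¬ pb))))
                  (refute (∧-snd pn pb) (⊑-trans (∧-fst pn pb) (∧-snd (P¬ pa) (P¬ pb))))))
    where
    pn : P (¬f a ∧f ¬f b)
    pn = P∧ (P¬ pa) (P¬ pb)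

  Decides : Fm → Fm → Set
  Decides m a = m ⊑ a ⊎ m ⊑ ¬f a

  ⋀-P : ∀ {as} → All P as → P (⋀ as)
  ⋀-P []          = P⊤
  ⋀-P (pa ∷ pas) = P∧ pa (⋀-P pas)

  ⋀-lb : ∀ {as a} → All P as → a ∈ as → ⋀ as ⊑ a
  ⋀-lb (pa ∷ pas) (here refl) = ∧-fst pa (⋀-P pas)
  ⋀-lb (pa ∷ pas) (there a∈)  = ∧L₂ᴾ pa (⋀-lb pas a∈)

  extend-branch : ∀ {m l a b L} → P m → P l → (b ⊑ l → Decides b a) →
                  P b × b ⊑ m ∧f l × All (Decides b) L → P b × b ⊑ m × All (Decides b) (a ∷ L)
  extend-branch pm pl side (pb , b⊑ , ds) =
    pb , ⊑-trans b⊑ (∧-fst pm pl) , side (⊑-trans b⊑ (∧-snd pm pl)) ∷ ds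

  branch-complete : ∀ L {m b} → All P L → P m → b ∈ branches L m →
                    P b × b ⊑ m × All (Decides b) L
  branch-complete []      _          pm (here refl) = pm , ⊑-refl pm , []
  branch-complete (a ∷ L) {m} (pa ∷ pL) pm b∈ with ∈-++⁻ (branches L (m ∧f a)) b∈
  ... | inj₁ b∈⁺ = extend-branch pm pa inj₁ (branch-complete L pL (P∧ pm pa) b∈⁺)
  ... | inj₂ b∈⁻ = extend-branch pm (P¬ pa) inj₂ (branch-complete L pL (P∧ pm (P¬ pa)) b∈⁻)

  regroup : ∀ {m p l} → P m → P p → P l → (m ∧f p) ∧f l ⊑ (m ∧f l) ∧f p
  regroup {m} {p} pm pp pl =
    ∧Rᴾ (∧Rᴾ (⊑-trans (∧-fst pmp pl) (∧-fst pm pp)) (∧-snd pmp pl))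
        (⊑-trans (∧-fst pmp pl) (∧-snd pm pp))
    where
    pmp : P (m ∧f p)
    pmp = P∧ pm pp

  cover : ∀ L {m p} → All P L → P m → P p →
          (∀ {b} → b ∈ branches L m → b ∧f p ⊑ ⊥f) → m ∧f p ⊑ ⊥f
  cover []      _          _  _  refuted = refuted (here refl)
  cover (a ∷ L) {m} (pa ∷ pL) pm pp refuted =
    by-cases (P∧ pm pp) pa
      (⊑-trans (regroup pm pp pa)
               (cover L pL (P∧ pm pa) pp (λ b∈ → refuted (∈-++⁺ˡ b∈))))
      (⊑-trans (regroup pm pp (P¬ pa))
               (cover L pL (P∧ pm (P¬ pa)) pp (λ b∈ → refuted (∈-++⁺ʳ (branches L (m ∧f a)) b∈))))

  -- If ◇^k ⊤ ∈ P for k ≤ 3, then ◇²⊤ is derivable from ⟨ψ⟩^(m+2) for every m: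
  -- the axiom ◇³⊤ ⇒ ◇²⊤ absorbs each further ◇.
  ◇²⊤-at-depth : (∀ {k} → k ≤ 3 → P (◇^ k ⊤f)) → ∀ {ψ} → P ψ →
                 ∀ m → P ⊢ (⟨ ψ ⟩^ suc (suc m)) ⇒ ◇^ 2 ⊤f
  ◇²⊤-at-depth P◇⊤ pψ zero    = ◇Rᴾ (P◇⊤ (s≤s (s≤s z≤n))) (◇Rᴾ (P◇⊤ (s≤s z≤n)) (⊤-intro pψ))
  ◇²⊤-at-depth P◇⊤ pψ (suc m) =
    cutᴾ (◇Rᴾ P◇³⊤ (◇²⊤-at-depth P◇⊤ pψ m)) (ax-dia ⊤f , (P◇³⊤ , P◇⊤ (s≤s (s≤s z≤n))) , tt)
    where
    P◇³⊤ : P (◇^ 3 ⊤f)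
    P◇³⊤ = P◇⊤ (s≤s (s≤s (s≤s z≤n)))

  ⊤-at-depth : (∀ {k} → k ≤ 3 → P (◇^ k ⊤f)) → ∀ {ψ} → P ψ → ∀ n → P ⊢ ⟨ ψ ⟩^ n ⇒ ⊤f
  ⊤-at-depth P◇⊤ pψ zero          = ⊤-intro pψ
  ⊤-at-depth P◇⊤ pψ (suc zero)    =
    cutᴾ (◇Rᴾ (P◇⊤ (s≤s z≤n)) (⊤-intro pψ)) (⊤-intro (P◇⊤ (s≤s z≤n)))
  ⊤-at-depth P◇⊤ pψ (suc (suc m)) =
    cutᴾ (◇²⊤-at-depth P◇⊤ pψ m) (⊤-intro (P◇⊤ (s≤s (s≤s z≤n))))

module Lattice (T : List Fm) (⊤∈T : ⊤f ∈ T) (⊥∈T : ⊥f ∈ T) where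

  ◇⊤∈T° : ∀ {k} → k ≤ 3 → TCirc T (◇^ k ⊤f)
  ◇⊤∈T° k≤3 = base (⊤f , _ , ⊤∈T , k≤3 , refl)

  ⊤∈T° : TCirc T ⊤f
  ⊤∈T° = ◇⊤∈T° z≤n

  ⊥∈T° : TCirc T ⊥f
  ⊥∈T° = base (⊥f , 0 , ⊥∈T , z≤n , refl)

  open Calculus {TCirc T} ⊤∈T° ⊥∈T° neg conj disj

  atoms-T° : All (TCirc T) (atoms T)
  atoms-T° = All.tabulate (base ∘ atoms-sound T)

  ⟦⟧⊆T° : ∀ {φ} → ⟦ T ⟧ φ ⊆ FS T (TCirc T)
  ⟦⟧⊆T° (inj₁ (dψ , _)) = base dψ
  ⟦⟧⊆T° (inj₂ (pψ , _)) = pψ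

  T°⊆⟦⊤⟧ : FS T (TCirc T) ⊆ ⟦ T ⟧ ⊤f
  T°⊆⟦⊤⟧ {⟨ ψ ⟩^ n} pψ with TDia? T ψ
  ... | yes dψ = inj₁ (dψ , ⊤-at-depth ◇⊤∈T° pψ n)
  ... | no ¬dψ = inj₂ (pψ , ¬dψ)

  ⟦⊤⟧≐T° : ⟦ T ⟧ ⊤f ≐ FS T (TCirc T)
  ⟦⊤⟧≐T° = ⟦⟧⊆T° , T°⊆⟦⊤⟧

  ⟦⟧-mono : ∀ {a b} → a ⊑ b → ⟦ T ⟧ a ⊆ ⟦ T ⟧ b
  ⟦⟧-mono a⊑b {⟨ _ ⟩^ _} (inj₁ (dψ , d)) = inj₁ (dψ , cutᴾ d a⊑b)
  ⟦⟧-mono a⊑b           (inj₂ bψ)       = inj₂ bψ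

  ⟦⟧-∧ : ∀ {X : Pred Struct 0ℓ} {a b} → X ⊆ ⟦ T ⟧ a → X ⊆ ⟦ T ⟧ b → X ⊆ ⟦ T ⟧ (a ∧f b)
  ⟦⟧-∧ X⊆⟦a⟧ X⊆⟦b⟧ x with X⊆⟦a⟧ x | X⊆⟦b⟧ x
  ... | inj₁ (dψ , d) | inj₁ (_ , e) = inj₁ (dψ , ∧Rᴾ d e)
  ... | inj₂ bψ       | _            = inj₂ bψ
  ... | inj₁ _        | inj₂ bψ      = inj₂ bψ

  ⟦⟧-⋀ : ∀ {X : Pred Struct 0ℓ} {as} → X ⊆ FS T (TCirc T) →
         All (λ a → X ⊆ ⟦ T ⟧ a) as → X ⊆ ⟦ T ⟧ (⋀ as)
  ⟦⟧-⋀ X⊆T° []               = T°⊆⟦⊤⟧ ∘ X⊆T°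
  ⟦⟧-⋀ X⊆T° (X⊆⟦a⟧ ∷ X⊆⟦as⟧) = ⟦⟧-∧ X⊆⟦a⟧ (⟦⟧-⋀ X⊆T° X⊆⟦as⟧)

  decides-T° : ∀ {m} → (∀ {a} → TDia T a → Decides m a) → ∀ {φ} → TCirc T φ → Decides m φ
  decides-T° atomic (base dφ) = atomic dφ
  decides-T° atomic (neg pφ) with decides-T° atomic pφ
  ... | inj₁ m⊑φ  = inj₂ (⊑-trans m⊑φ (¬¬-intro pφ))
  ... | inj₂ m⊑¬φ = inj₁ m⊑¬φ
  decides-T° atomic (conj pφ pψ) with decides-T° atomic pφ | decides-T° atomic pψ
  ... | inj₁ m⊑φ  | inj₁ m⊑ψ  = inj₁ (∧Rᴾ m⊑φ m⊑ψ)
  ... | inj₂ m⊑¬φ | _         = inj₂ (⊑-trans m⊑¬φ (¬-antitone (∧-fst pφ pψ)))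
  ... | inj₁ _    | inj₂ m⊑¬ψ = inj₂ (⊑-trans m⊑¬ψ (¬-antitone (∧-snd pφ pψ)))
  decides-T° atomic (disj pφ pψ) with decides-T° atomic pφ | decides-T° atomic pψ
  ... | inj₁ m⊑φ  | _         = inj₁ (∨R₁ᴾ pψ m⊑φ)
  ... | inj₂ _    | inj₁ m⊑ψ  = inj₁ (∨R₂ᴾ pφ m⊑ψ)
  ... | inj₂ m⊑¬φ | inj₂ m⊑¬ψ = inj₂ (⊑-trans (∧Rᴾ m⊑¬φ m⊑¬ψ) (¬-∨ pφ pψ))

  module Generator (em : ExcludedMiddle 0ℓ) (X : Pred Struct 0ℓ)
                   (X⊆T° : X ⊆ FS T (TCirc T)) where

    Bound : Fm → Set
    Bound ψ = TCirc T ψ × X ⊆ ⟦ T ⟧ ψ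

    RefutesBound : Fm → Set
    RefutesBound b = Σ Fm λ φ → Bound φ × b ⊑ ¬f φ

    choose : ∀ b → Σ Fm λ ψ → Bound ψ × (RefutesBound b → b ⊑ ¬f ψ)
    choose b with em {RefutesBound b}
    ... | yes (φ , bound , b⊑¬φ) = φ , bound , λ _ → b⊑¬φ
    ... | no none                = ⊤f , (⊤∈T° , T°⊆⟦⊤⟧ ∘ X⊆T°) , ⊥-elim ∘ none

    pick : Fm → Fm
    pick b = proj₁ (choose b)

    full : List Fm
    full = branches (atoms T) ⊤f

    χ : Fm
    χ = ⋀ (map pick full)

    picks-bound : All Bound (map pick full)
    picks-bound = map⁺ (universal (proj₁ ∘ proj₂ ∘ choose) full)

    χ-bound : Bound χ
    χ-bound = ⋀-P (All.map proj₁ picks-bound) , ⟦⟧-⋀ X⊆T° (All.map proj₂ picks-bound)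

    χ∈T° : TCirc T χ
    χ∈T° = proj₁ χ-bound

    χ⊑pick : ∀ {b} → b ∈ full → χ ⊑ pick b
    χ⊑pick b∈ = ⋀-lb (All.map proj₁ picks-bound) (∈-map⁺ pick b∈)

    -- Every full branch b refutes χ ∧ ¬φ: b decides φ; if b ⊑ φ this contradicts ¬φ,
    -- and if b ⊑ ¬φ then b also refutes its chosen bound, which lies above χ.
    refuted-on-branch : ∀ {φ b} → Bound φ → b ∈ full → b ∧f (χ ∧f ¬f φ) ⊑ ⊥f
    refuted-on-branch {φ} {b} bound@(pφ , _) b∈ =
      let pb , _ , decs = branch-complete (atoms T) atoms-T° ⊤∈T° b∈
      in by-decision pb (decides-T° (All.lookup decs ∘ atoms-complete T) pφ)
      where
      p : TCirc T (χ ∧f ¬f φ)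
      p = conj χ∈T° (neg pφ)
      by-decision : TCirc T b → Decides b φ → b ∧f (χ ∧f ¬f φ) ⊑ ⊥f
      by-decision pb (inj₁ b⊑φ) =
        refute (⊑-trans (∧-fst pb p) b⊑φ)
               (⊑-trans (∧-snd pb p) (∧-snd χ∈T° (neg pφ)))
      by-decision pb (inj₂ b⊑¬φ) =
        refute (⊑-trans (∧-snd pb p) (⊑-trans (∧-fst χ∈T° (neg pφ)) (χ⊑pick b∈)))
               (⊑-trans (∧-fst pb p) (proj₂ (proj₂ (choose b)) (φ , bound , b⊑¬φ)))

    χ-least : ∀ {φ} → Bound φ → χ ⊑ φ
    χ-least {φ} bound@(pφ , _) = ⊑-trans (¬-intro χ∈T° (neg pφ) refutation) (¬¬-elim pφ)
      where
      p : TCirc T (χ ∧f ¬f φ)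
      p = conj χ∈T° (neg pφ)
      refutation : χ ∧f ¬f φ ⊑ ⊥f
      refutation = ⊑-trans (∧Rᴾ (⊤-intro p) (⊑-refl p))
                           (cover (atoms T) atoms-T° ⊤∈T° p (refuted-on-branch bound))

    generator : Σ Fm λ χ → TCirc T χ × (Cl T X ≐ ⟦ T ⟧ χ)
    generator = χ , χ∈T°
              , (λ c → c χ χ∈T° (proj₂ χ-bound))
              , (λ x φ pφ X⊆⟦φ⟧ → ⟦⟧-mono (χ-least (pφ , X⊆⟦φ⟧)) x)

Cl-extensive : ∀ T {X} → X ⊆ Cl T X
Cl-extensive T x _ _ X⊆⟦φ⟧ = X⊆⟦φ⟧ x

Cl-monotone : ∀ T {X Y} → X ⊆ Y → Cl T X ⊆ Cl T Y
Cl-monotone T X⊆Y c φ pφ Y⊆⟦φ⟧ = c φ pφ (Y⊆⟦φ⟧ ∘ X⊆Y)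

Cl-idempotent : ∀ T {X} → Cl T (Cl T X) ⊆ Cl T X
Cl-idempotent T c φ pφ X⊆⟦φ⟧ = c φ pφ (λ c′ → c′ φ pφ X⊆⟦φ⟧)

Cl-⟦⟧ : ∀ T {φ} → TCirc T φ → Cl T (⟦ T ⟧ φ) ≐ ⟦ T ⟧ φ
Cl-⟦⟧ T pφ = (λ c → c _ pφ id) , Cl-extensive T

lemma3p8 : (T : List Fm) → ⊤f ∈ T → ⊥f ∈ T →
    (X Y : Pred Struct 0ℓ) → X ⊆ FS T (TCirc T) → Y ⊆ FS T (TCirc T) →
    (φ : Fm) → TCirc T φ →
      (⟦ T ⟧ ⊤f ≐ FS T (TCirc T))
      × (ExcludedMiddle 0ℓ → Σ Fm λ χ → TCirc T χ × (Cl T X ≐ ⟦ T ⟧ χ))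
      × (X ⊆ Cl T X)
      × (X ⊆ Y → Cl T X ⊆ Cl T Y)
      × (Cl T (Cl T X) ⊆ Cl T X)
      × (Cl T (⟦ T ⟧ φ) ≐ ⟦ T ⟧ φ)
lemma3p8 T ⊤∈T ⊥∈T X _ X⊆T° _ _ pφ =
    ⟦⊤⟧≐T°
  , (λ em → Generator.generator em X X⊆T°)
  , Cl-extensive T
  , Cl-monotone T
  , Cl-idempotent T
  , Cl-⟦⟧ T pφ
  where open Lattice T ⊤∈T ⊥∈T
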